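{- Let $G$, $G'$ and $H$ be game forms (short partizan games). If $G=G'$, then $\{G\,|\,\}:H=\{G'\,|\,\}:H$.
   Context: Games are short partizan combinatorial games under the normal play convention; a game form is written $\{G^{\mathcal L}\,|\,G^{\mathcal R}\}$, and $G=H$ means $G-H$ is a second-player win. For game forms $G,H$, the ordinal sum $G:H$ is defined recursively by $G:H=\{G^{\mathcal L},\,G:H^{\mathcal L}\,|\,G^{\mathcal R},\,G:H^{\mathcal R}\}$, where $G^{\mathcal L},G^{\mathcal R}$ range over the Left/Right options of the literal form of $G$ (the base) and $H^{\mathcal L},H^{\mathcal R}$ over those of $H$ (the subordinate); i.e. a player may move in $G$ or in $H$, and a move in $G$ annihilates $H$. The form $\{G\,|\,\}$ denotes the game whose only Left option is $G$ and which has no Right options. -}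

module Defs where

open import Data.Nat using (ℕ; zero; suc; _+_)
open import Data.Fin using (Fin; splitAt)
open import Data.Sum using (_⊎_; inj₁; inj₂; [_,_])
open import Data.Product using (Σ; _×_)
open import Data.Empty using (⊥)
open import Relation.Nullary using (¬_)

-- A short partizan game FORM: finitely many Left options and finitely many
-- Right options (indexed by Fin), each again a game form.  Well-foundedness
-- (and hence shortness) is built in by the inductive type.
data Game : Set where
  mk : (nL nR : ℕ) → (Fin nL → Game) → (Fin nR → Game) → Game

nL : Game → ℕ
nL (mk l _ _ _) = l

nR : Game → ℕ
nR (mk _ r _ _) = r

optL : (G : Game) → Fin (nL G) → Game
optL (mk _ _ gl _) = gl

optR : (G : Game) → Fin (nR G) → Game
optR (mk _ _ _ gr) = gr

-- disjunctive sum  G + H = { G^L + H, G + H^L | G^R + H, G + H^R }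
_⊕_ : Game → Game → Game
mk a b gl gr ⊕ mk c d hl hr =
  mk (a + c) (b + d)
     (λ i → [ (λ j → gl j ⊕ mk c d hl hr) , (λ k → mk a b gl gr ⊕ hl k) ] (splitAt a i))
     (λ i → [ (λ j → gr j ⊕ mk c d hl hr) , (λ k → mk a b gl gr ⊕ hr k) ] (splitAt b i))

neg : Game → Game
neg (mk a b gl gr) = mk b a (λ i → neg (gr i)) (λ i → neg (gl i))

-- Outcomes under normal play (a player with no move on their turn loses).
mutual
  LeftFirst : Game → Set
  LeftFirst (mk a b gl gr) = Σ (Fin a) (λ i → LeftSecond (gl i))

  LeftSecond : Game → Set
  LeftSecond (mk a b gl gr) = (j : Fin b) → LeftFirst (gr j)

mutual
  RightFirst : Game → Set
  RightFirst (mk a b gl gr) = Σ (Fin b) (λ j → RightSecond (gr j))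

  RightSecond : Game → Set
  RightSecond (mk a b gl gr) = (i : Fin a) → RightFirst (gl i)

SecondPlayerWin : Game → Set
SecondPlayerWin G = RightSecond G × LeftSecond G

_≈G_ : Game → Game → Set
G ≈G H = SecondPlayerWin (G ⊕ neg H)

-- Ordinal sum  G : H = { G^L, G:H^L | G^R, G:H^R }  (on literal forms).
_∶_ : Game → Game → Game
mk a b gl gr ∶ mk c d hl hr =
  mk (a + c) (b + d)
     (λ i → [ gl , (λ k → mk a b gl gr ∶ hl k) ] (splitAt a i))
     (λ i → [ gr , (λ k → mk a b gl gr ∶ hr k) ] (splitAt b i))

leftOnly : Game → Game
leftOnly G = mk 1 0 (λ _ → G) (λ ())

{-# OPTIONS --safe #-}
module Submission where

-- If two forms have the same numbers of Left and Right options and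
-- corresponding options are equal, they are equal: in their difference the second
-- player answers every move by the corresponding move in the other component.
-- The options of {G|}:H and {G'|}:H correspond in exactly this way, the base
-- options G, G' being equal by hypothesis and the subordinate ones by induction on H.

open import Defs
open import Data.Fin using (Fin; splitAt; _↑ˡ_; _↑ʳ_)
open import Data.Fin.Properties using (splitAt-↑ˡ; splitAt-↑ʳ)
open import Data.Sum using (inj₁; inj₂; [_,_])
open import Data.Product using (_,_; proj₁; proj₂)
open import Relation.Binary.PropositionalEquality using (sym; subst)

leftFirst-⊕ˡ : ∀ X Y i → LeftSecond (optL X i ⊕ Y) → LeftFirst (X ⊕ Y)
leftFirst-⊕ˡ X@(mk a _ gl _) Y@(mk c _ hl _) i win =
  i ↑ˡ c , subst (λ s → LeftSecond ([ (λ i → gl i ⊕ Y) , (λ k → X ⊕ hl k) ] s))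
                 (sym (splitAt-↑ˡ a i c)) win

leftFirst-⊕ʳ : ∀ X Y k → LeftSecond (X ⊕ optL Y k) → LeftFirst (X ⊕ Y)
leftFirst-⊕ʳ X@(mk a _ gl _) Y@(mk c _ hl _) k win =
  a ↑ʳ k , subst (λ s → LeftSecond ([ (λ i → gl i ⊕ Y) , (λ k → X ⊕ hl k) ] s))
                 (sym (splitAt-↑ʳ a c k)) win

rightFirst-⊕ˡ : ∀ X Y j → RightSecond (optR X j ⊕ Y) → RightFirst (X ⊕ Y)
rightFirst-⊕ˡ X@(mk _ b _ gr) Y@(mk _ d _ hr) j win =
  j ↑ˡ d , subst (λ s → RightSecond ([ (λ j → gr j ⊕ Y) , (λ k → X ⊕ hr k) ] s))
                 (sym (splitAt-↑ˡ b j d)) win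

rightFirst-⊕ʳ : ∀ X Y k → RightSecond (X ⊕ optR Y k) → RightFirst (X ⊕ Y)
rightFirst-⊕ʳ X@(mk _ b _ gr) Y@(mk _ d _ hr) k win =
  b ↑ʳ k , subst (λ s → RightSecond ([ (λ j → gr j ⊕ Y) , (λ k → X ⊕ hr k) ] s))
                 (sym (splitAt-↑ʳ b d k)) win

mk-cong : ∀ {a b} {gl gl' : Fin a → Game} {gr gr' : Fin b → Game} →
          (∀ i → gl i ≈G gl' i) → (∀ j → gr j ≈G gr' j) →
          mk a b gl gr ≈G mk a b gl' gr'
mk-cong {a} {b} {gl} {gl'} {gr} {gr'} gl≈gl' gr≈gr' = rightSecond , leftSecond
  where
  X = mk a b gl gr
  -Y = neg (mk a b gl' gr')

  rightSecond : RightSecond (X ⊕ -Y)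
  rightSecond i with splitAt a i
  ... | inj₁ i′ = rightFirst-⊕ʳ (gl i′) -Y i′ (proj₁ (gl≈gl' i′))
  ... | inj₂ j  = rightFirst-⊕ˡ X (neg (gr' j)) j (proj₁ (gr≈gr' j))

  leftSecond : LeftSecond (X ⊕ -Y)
  leftSecond j with splitAt b j
  ... | inj₁ j′ = leftFirst-⊕ʳ (gr j′) -Y j′ (proj₂ (gr≈gr' j′))
  ... | inj₂ i  = leftFirst-⊕ˡ X (neg (gl' i)) i (proj₂ (gl≈gl' i))

[,]-cong-≈G : ∀ {A B : Set} {f f' : A → Game} {g g' : B → Game} →
              (∀ x → f x ≈G f' x) → (∀ y → g y ≈G g' y) →
              ∀ s → [ f , g ] s ≈G [ f' , g' ] s
[,]-cong-≈G f≈f' g≈g' (inj₁ x) = f≈f' x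
[,]-cong-≈G f≈f' g≈g' (inj₂ y) = g≈g' y

∶-cong-optionwise : ∀ {a b} {gl gl' : Fin a → Game} {gr gr' : Fin b → Game} →
                    (∀ i → gl i ≈G gl' i) → (∀ j → gr j ≈G gr' j) →
                    ∀ H → (mk a b gl gr ∶ H) ≈G (mk a b gl' gr' ∶ H)
∶-cong-optionwise {a} {b} gl≈gl' gr≈gr' (mk _ _ hl hr) =
  mk-cong (λ i → [,]-cong-≈G gl≈gl' (λ k → ∶-cong-optionwise gl≈gl' gr≈gr' (hl k)) (splitAt a i))
          (λ j → [,]-cong-≈G gr≈gr' (λ k → ∶-cong-optionwise gl≈gl' gr≈gr' (hr k)) (splitAt b j))

theorem1p2 : (G G' H : Game) → G ≈G G' → (leftOnly G ∶ H) ≈G (leftOnly G' ∶ H)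
theorem1p2 G G' H G≈G' = ∶-cong-optionwise (λ _ → G≈G') (λ ()) H
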